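{- Let $\mathcal{P}$ be a regular poset with $n=r(\mathcal{P})$, and let $A\subset\mathcal{P}$. Define $f_A:\mathcal{P}\to\mathbb{R}$ by $f_A(x)=0$ if $x\in\mathcal{P}_0\setminus A$; $f_A(x)=1/N_0$ if $x\in\mathcal{P}_0\cap A$; $f_A(x)=1/N_n$ if $x\in\mathcal{P}_n\setminus\mathcal{U}(A)$; and $f_A(x)=\frac{W_A(x)}{d^-_{r(x)}N_{r(x)}}$ otherwise. Then $\sum_{x\in\mathcal{P}}f_A(x)=1$.
   Context: All posets are finite. A poset $\mathcal{P}$ is ranked with rank function $r$ if every minimal element has rank $0$ and $r(b)=r(a)+1$ whenever $b$ covers $a$; $\mathcal{P}_i$ is the set of elements of rank $i$, $N_i=|\mathcal{P}_i|$, and $r(\mathcal{P})$ is the maximum rank. $\mathcal{P}$ is regular if for every element $a$ both the number of elements covering $a$ and the number of elements covered by $a$ depend only on $r(a)$; $d^-_i$ denotes the number of elements covered by an element of rank $i$. For $x\in\mathcal{P}$, $\Gamma^-(x)$ is the set of elements covered by $x$; for $B\subset\mathcal{P}$, $\Gamma^+_i(B)=\{y\in\mathcal{P}_i: y\ge b\text{ for some } b\in B\}$; $\mathcal{U}(A)=\{b\in\mathcal{P}: b\ge a \text{ for some } a\in A\}$. For $x\in\mathcal{P}$ let $A^x=\{a\in A:a\le x\}$; $W_A(x)=0$ if $A^x=\emptyset$, and $W_A(x)=|\Gamma^-(x)\setminus\Gamma^+_{r(x)-1}(A^x)|$ otherwise. -}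

module Defs where

open import Data.Nat as ℕ using (ℕ; zero; suc; _*_; _∸_)
import Data.Nat.Properties as ℕP
open import Data.Fin using (Fin)
open import Data.Fin.Properties using (any?; _≟_)
open import Data.Fin.Subset using (Subset; _∈_)
open import Data.Fin.Subset.Properties using (_∈?_)
open import Data.List using (List; length; filter; foldr; map)
open import Data.List.Base using (allFin)
open import Data.Product using (_×_; _,_; ∃; ∃-syntax)
open import Data.Bool using (Bool; true; false; if_then_else_)
open import Data.Integer using (+_)
open import Data.Rational using (ℚ; 0ℚ; _/_; _+_)
open import Relation.Nullary using (¬_; Dec; yes; no; does; ¬?)
open import Relation.Nullary.Decidable using (_×-dec_)
open import Relation.Binary using (Decidable; IsPartialOrder)
open import Relation.Binary.PropositionalEquality using (_≡_; _≢_)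

record FinPoset (m : ℕ) : Set₁ where
  field
    _≤_            : Fin m → Fin m → Set
    isPartialOrder : IsPartialOrder _≡_ _≤_
    _≤?_           : Decidable _≤_

count : ∀ {m} {P : Fin m → Set} → ((x : Fin m) → Dec (P x)) → ℕ
count P? = length (filter P? (allFin _))

-- total division of naturals into ℚ (value 0 when the denominator is 0;
-- under the theorem's hypotheses no denominator that is used is 0)
_//_ : ℕ → ℕ → ℚ
a // zero  = 0ℚ
a // suc d = (+ a) / suc d

Σℚ : ∀ {m} → (Fin m → ℚ) → ℚ
Σℚ {m} f = foldr _+_ 0ℚ (map f (allFin m))

module _ {m : ℕ} (P : FinPoset m) where
  open FinPoset P

  _<_ : Fin m → Fin m → Set
  a < b = (a ≤ b) × ¬ (a ≡ b)

  _<?_ : (a b : Fin m) → Dec (a < b)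
  a <? b = (a ≤? b) ×-dec ¬? (a ≟ b)

  _⋖_ : Fin m → Fin m → Set
  a ⋖ b = (a < b) × ¬ (∃[ c ] ((a < c) × (c < b)))

  _⋖?_ : (a b : Fin m) → Dec (a ⋖ b)
  a ⋖? b = (a <? b) ×-dec ¬? (any? (λ c → (a <? c) ×-dec (c <? b)))

  Minimal : Fin m → Set
  Minimal a = ¬ (∃[ b ] (b < a))

  IsRankFunction : (Fin m → ℕ) → Set
  IsRankFunction r = (∀ a → Minimal a → r a ≡ 0)
                   × (∀ a b → a ⋖ b → r b ≡ suc (r a))

  up-deg : Fin m → ℕ
  up-deg a = count (λ b → a ⋖? b)

  down-deg : Fin m → ℕ
  down-deg a = count (λ b → b ⋖? a)

  -- regularity w.r.t. the rank function r, with d⁺_i = dp i and d⁻_i = dm i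
  IsRegular : (Fin m → ℕ) → (ℕ → ℕ) → (ℕ → ℕ) → Set
  IsRegular r dp dm = ∀ a → (up-deg a ≡ dp (r a)) × (down-deg a ≡ dm (r a))

  IsMaxRank : (Fin m → ℕ) → ℕ → Set
  IsMaxRank r n = (∃[ x ] (r x ≡ n)) × (∀ x → r x ℕ.≤ n)

  module _ (r : Fin m → ℕ) where
    N : ℕ → ℕ
    N i = count (λ x → r x ℕP.≟ i)

    module _ (A : Subset m) where
      inUp? : (x : Fin m) → Dec (∃[ a ] ((a ∈ A) × (a ≤ x)))
      inUp? x = any? (λ a → (a ∈? A) ×-dec (a ≤? x))

      -- A^x ≠ ∅  (same predicate as x ∈ 𝒰(A))
      Ax-nonempty? : (x : Fin m) → Dec (∃[ a ] ((a ∈ A) × (a ≤ x)))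
      Ax-nonempty? = inUp?

      -- y ∈ Γ⁺_{r(x)-1}(A^x)
      inΓ⁺? : (x y : Fin m) → Dec ((r y ≡ r x ∸ 1) × ∃[ a ] (((a ∈ A) × (a ≤ x)) × (a ≤ y)))
      inΓ⁺? x y = (r y ℕP.≟ r x ∸ 1)
                  ×-dec any? (λ a → ((a ∈? A) ×-dec (a ≤? x)) ×-dec (a ≤? y))

      W : Fin m → ℕ
      W x with does (Ax-nonempty? x)
      ... | false = 0
      ... | true  = count (λ y → (y ⋖? x) ×-dec ¬? (inΓ⁺? x y))

      -- f_A (cases tested in the order of the paper), n = r(P), dm i = d⁻_i
      f : (n : ℕ) → (ℕ → ℕ) → Fin m → ℚ
      f n dm x =
        if does (r x ℕP.≟ 0)
        then (if does (x ∈? A) then 1 // N 0 else 0ℚ)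
        else (if does ((r x ℕP.≟ n) ×-dec ¬? (inUp? x))
              then 1 // N n
              else W x // (dm (r x) * N (r x)))

module Submission where

-- Write 𝒰 = 𝒰(A), e_i = 1/N_i and c_i = 1/(d⁻_i N_i).  Pointwise,
--   f_A(x) = H(x) - G(x),  H(x) = [x ∈ 𝒰] e_{r(x)} + [r(x) = n, x ∉ 𝒰] e_n,
--                          G(x) = #{y ⋖ x : y ∈ 𝒰} · c_{r(x)},
-- because for x ∈ 𝒰 the number W_A(x) counts exactly the lower covers of x
-- outside 𝒰, so W_A(x) = d⁻_{r(x)} - #{y ⋖ x : y ∈ 𝒰}.  Exchanging the order
-- of summation, Σ_x G(x) = Σ_{y ∈ 𝒰} d⁺_{r(y)} c_{r(y)+1}, and double counting
-- the covers between consecutive ranks (N_i d⁺_i = N_{i+1} d⁻_{i+1}) turns this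
-- into Σ_y K(y) with K(y) = [y ∈ 𝒰, r(y) ≠ n] e_{r(y)}.  Finally H - K is e_n
-- on the top rank and 0 elsewhere, so the total is N_n e_n = 1.

open import Defs
open import Data.Nat using (ℕ; _≤_)
open import Data.Fin.Subset using (Subset)
open import Data.Fin using (Fin)
open import Data.Rational using (ℚ; 1ℚ)
open import Relation.Binary.PropositionalEquality using (_≡_)

open import Data.Nat as ℕ using (zero; suc; s≤s; _∸_)
import Data.Nat.Properties as ℕP
open import Data.Integer as ℤ using (+_)
import Data.Integer.Properties as ℤP
open import Data.Rational as ℚ using (0ℚ; _+_; _*_; _-_)
import Data.Rational.Properties as ℚP
open import Data.Rational.Unnormalised as ℚᵘ using (mkℚᵘ; *≡*)
import Data.Rational.Unnormalised.Properties as ℚᵘP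
open import Data.Rational.Solver using (module +-*-Solver)
open import Data.Fin.Properties using (any?; _≟_)
open import Data.Fin.Induction using (po-noetherian)
open import Data.Fin.Subset using (_∈_)
open import Data.Fin.Subset.Properties using (_∈?_)
open import Data.List using (List; []; _∷_; foldr; map; filter; length; allFin)
open import Data.List.Properties using (filter-some)
open import Data.List.Membership.Propositional using (lose)
open import Data.List.Membership.Propositional.Properties using (∈-allFin)
open import Data.Product using (_×_; _,_; ∃-syntax; proj₁; proj₂)
open import Data.Bool using (if_then_else_)
open import Function using (flip)
open import Induction.WellFounded using (Acc; acc)
open import Relation.Binary using (IsPartialOrder)
open import Relation.Nullary using (¬_; Dec; yes; no; does; contradiction; ¬?)
open import Relation.Nullary.Decidable using (_×-dec_)
open import Relation.Binary.PropositionalEquality using (_≢_; refl; sym; trans; cong; cong₂; subst; module ≡-Reasoning)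

open +-*-Solver

ι : ℕ → ℚ
ι a = + a ℚ./ 1

-- ι is a semiring homomorphism; both facts are checked on unnormalised
-- representatives, where they are integer identities.
toℚᵘ-ι : ∀ a → ℚ.toℚᵘ (ι a) ℚᵘ.≃ mkℚᵘ (+ a) 0
toℚᵘ-ι a = ℚP.toℚᵘ-fromℚᵘ (mkℚᵘ (+ a) 0)

ι-+ : ∀ a b → ι (a ℕ.+ b) ≡ ι a + ι b
ι-+ a b = ℚP.toℚᵘ-injective (begin
    ℚ.toℚᵘ (ι (a ℕ.+ b))              ≈⟨ toℚᵘ-ι (a ℕ.+ b) ⟩
    mkℚᵘ (+ (a ℕ.+ b)) 0              ≈⟨ *≡* (cong (ℤ._* + 1) (trans (ℤP.pos-+ a b) (sym (cong₂ ℤ._+_ (ℤP.*-identityʳ (+ a)) (ℤP.*-identityʳ (+ b)))))) ⟩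
    mkℚᵘ (+ a) 0 ℚᵘ.+ mkℚᵘ (+ b) 0    ≈⟨ ℚᵘP.+-cong (ℚᵘP.≃-sym (toℚᵘ-ι a)) (ℚᵘP.≃-sym (toℚᵘ-ι b)) ⟩
    ℚ.toℚᵘ (ι a) ℚᵘ.+ ℚ.toℚᵘ (ι b)    ≈⟨ ℚᵘP.≃-sym (ℚP.toℚᵘ-homo-+ (ι a) (ι b)) ⟩
    ℚ.toℚᵘ (ι a + ι b)                ∎)
  where open ℚᵘP.≃-Reasoning

ι-* : ∀ a b → ι (a ℕ.* b) ≡ ι a * ι b
ι-* a b = ℚP.toℚᵘ-injective (begin
    ℚ.toℚᵘ (ι (a ℕ.* b))              ≈⟨ toℚᵘ-ι (a ℕ.* b) ⟩
    mkℚᵘ (+ (a ℕ.* b)) 0              ≈⟨ *≡* (cong (ℤ._* + 1) (ℤP.pos-* a b)) ⟩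
    mkℚᵘ (+ a) 0 ℚᵘ.* mkℚᵘ (+ b) 0    ≈⟨ ℚᵘP.*-cong (ℚᵘP.≃-sym (toℚᵘ-ι a)) (ℚᵘP.≃-sym (toℚᵘ-ι b)) ⟩
    ℚ.toℚᵘ (ι a) ℚᵘ.* ℚ.toℚᵘ (ι b)    ≈⟨ ℚᵘP.≃-sym (ℚP.toℚᵘ-homo-* (ι a) (ι b)) ⟩
    ℚ.toℚᵘ (ι a * ι b)                ∎)
  where open ℚᵘP.≃-Reasoning

//-*-cancel : ∀ a {D} → 0 ℕ.< D → (a // D) * ι D ≡ ι a
//-*-cancel a {suc d} _ = ℚP.toℚᵘ-injective (begin
    ℚ.toℚᵘ ((a // suc d) * ι (suc d))              ≈⟨ ℚP.toℚᵘ-homo-* (a // suc d) (ι (suc d)) ⟩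
    ℚ.toℚᵘ (a // suc d) ℚᵘ.* ℚ.toℚᵘ (ι (suc d))    ≈⟨ ℚᵘP.*-cong (ℚP.toℚᵘ-fromℚᵘ (mkℚᵘ (+ a) d)) (toℚᵘ-ι (suc d)) ⟩
    mkℚᵘ (+ a) d ℚᵘ.* mkℚᵘ (+ suc d) 0             ≈⟨ *≡* (ℤP.*-assoc (+ a) (+ suc d) (+ 1)) ⟩
    mkℚᵘ (+ a) 0                                   ≈⟨ ℚᵘP.≃-sym (toℚᵘ-ι a) ⟩
    ℚ.toℚᵘ (ι a)                                   ∎)
  where open ℚᵘP.≃-Reasoning

*-cancelʳ-ι : ∀ {D} → 0 ℕ.< D → ∀ u v → u * ι D ≡ v * ι D → u ≡ v
*-cancelʳ-ι {D} D>0 u v uD≡vD = trans (sym (undo u)) (trans (cong (_* (1 // D)) uD≡vD) (undo v))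
  where
  undo : ∀ w → (w * ι D) * (1 // D) ≡ w
  undo w = begin
    (w * ι D) * (1 // D)  ≡⟨ solve 3 (λ w i k → (w :* i) :* k := w :* (k :* i)) refl w (ι D) (1 // D) ⟩
    w * ((1 // D) * ι D)  ≡⟨ cong (w *_) (//-*-cancel 1 D>0) ⟩
    w * 1ℚ                ≡⟨ ℚP.*-identityʳ w ⟩
    w                     ∎
    where open ≡-Reasoning

//-split : ∀ a {D} → 0 ℕ.< D → a // D ≡ ι a * (1 // D)
//-split a {D} D>0 = *-cancelʳ-ι D>0 _ _ (begin
    (a // D) * ι D          ≡⟨ //-*-cancel a D>0 ⟩
    ι a                     ≡⟨ sym (ℚP.*-identityʳ (ι a)) ⟩
    ι a * 1ℚ                ≡⟨ cong (ι a *_) (sym (//-*-cancel 1 D>0)) ⟩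
    ι a * ((1 // D) * ι D)  ≡⟨ sym (ℚP.*-assoc (ι a) (1 // D) (ι D)) ⟩
    (ι a * (1 // D)) * ι D  ∎)
  where open ≡-Reasoning

*-//-cancel : ∀ a {b D} → 0 ℕ.< b → 0 ℕ.< D → ι a * ι b ≡ ι D → ι a * (1 // D) ≡ 1 // b
*-//-cancel a {b} {D} b>0 D>0 ab≡D = *-cancelʳ-ι b>0 _ _ (begin
    (ι a * (1 // D)) * ι b  ≡⟨ solve 3 (λ x y z → (x :* y) :* z := y :* (x :* z)) refl (ι a) (1 // D) (ι b) ⟩
    (1 // D) * (ι a * ι b)  ≡⟨ cong ((1 // D) *_) ab≡D ⟩
    (1 // D) * ι D          ≡⟨ //-*-cancel 1 D>0 ⟩
    1ℚ                      ≡⟨ sym (//-*-cancel 1 b>0) ⟩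
    (1 // b) * ι b          ∎)
  where open ≡-Reasoning

[_] : ∀ {p} {Q : Set p} → Dec Q → ℚ
[ d ] = if does d then 1ℚ else 0ℚ

sumOver : ∀ {X : Set} → List X → (X → ℚ) → ℚ
sumOver l g = foldr _+_ 0ℚ (map g l)

module _ {X : Set} where

  sum-cong : ∀ (l : List X) {g h : X → ℚ} → (∀ x → g x ≡ h x) → sumOver l g ≡ sumOver l h
  sum-cong []      g≗h = refl
  sum-cong (a ∷ l) g≗h = cong₂ _+_ (g≗h a) (sum-cong l g≗h)

  sum-zero : ∀ (l : List X) → sumOver l (λ _ → 0ℚ) ≡ 0ℚ
  sum-zero []      = refl
  sum-zero (a ∷ l) = cong (λ t → 0ℚ + t) (sum-zero l)

  sum-+ : ∀ (l : List X) (g h : X → ℚ) → sumOver l (λ x → g x + h x) ≡ sumOver l g + sumOver l h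
  sum-+ []      g h = refl
  sum-+ (a ∷ l) g h rewrite sum-+ l g h =
    solve 4 (λ p q s t → (p :+ q) :+ (s :+ t) := (p :+ s) :+ (q :+ t)) refl (g a) (h a) (sumOver l g) (sumOver l h)

  sum-- : ∀ (l : List X) (g h : X → ℚ) → sumOver l (λ x → g x - h x) ≡ sumOver l g - sumOver l h
  sum-- []      g h = refl
  sum-- (a ∷ l) g h rewrite sum-- l g h =
    solve 4 (λ p q s t → (p :- q) :+ (s :- t) := (p :+ s) :- (q :+ t)) refl (g a) (h a) (sumOver l g) (sumOver l h)

  sum-*ʳ : ∀ (l : List X) (g : X → ℚ) c → sumOver l (λ x → g x * c) ≡ sumOver l g * c
  sum-*ʳ []      g c = sym (ℚP.*-zeroˡ c)
  sum-*ʳ (a ∷ l) g c rewrite sum-*ʳ l g c = sym (ℚP.*-distribʳ-+ c (g a) (sumOver l g))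

  sum-swap : ∀ (l₁ l₂ : List X) (g : X → X → ℚ) →
             sumOver l₁ (λ x → sumOver l₂ (g x)) ≡ sumOver l₂ (λ y → sumOver l₁ (λ x → g x y))
  sum-swap []       l₂ g = sym (sum-zero l₂)
  sum-swap (a ∷ l₁) l₂ g rewrite sum-swap l₁ l₂ g = sym (sum-+ l₂ (g a) (λ y → sumOver l₁ (λ x → g x y)))

  sum-indicator : ∀ {p} {P : X → Set p} (P? : ∀ x → Dec (P x)) (l : List X) →
                  sumOver l (λ x → [ P? x ]) ≡ ι (length (filter P? l))
  sum-indicator P? []      = refl
  sum-indicator P? (a ∷ l) with P? a
  ... | yes _ = trans (cong (λ t → 1ℚ + t) (sum-indicator P? l)) (sym (ι-+ 1 (length (filter P? l))))
  ... | no  _ = trans (ℚP.+-identityˡ _) (sum-indicator P? l)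

indicator-iff : ∀ {p q} {X : Set p} {Y : Set q} (x? : Dec X) (y? : Dec Y) → (X → Y) → (Y → X) → [ x? ] ≡ [ y? ]
indicator-iff (yes _) (yes _) _   _   = refl
indicator-iff (yes x) (no ¬y) x→y _   = contradiction (x→y x) ¬y
indicator-iff (no ¬x) (yes y) _   y→x = contradiction (y→x y) ¬x
indicator-iff (no _)  (no _)  _   _   = refl

indicator-*-cong : ∀ {p} {X : Set p} (x? : Dec X) {a b : ℚ} → (X → a ≡ b) → [ x? ] * a ≡ [ x? ] * b
indicator-*-cong (yes x) a≡b = cong (1ℚ *_) (a≡b x)
indicator-*-cong (no _) {a} {b} _ = trans (ℚP.*-zeroˡ a) (sym (ℚP.*-zeroˡ b))

indicator-split : ∀ {p q s} {C : Set p} {Γ : Set q} {V : Set s} (c? : Dec C) (γ? : Dec Γ) (v? : Dec V) →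
                  (C → Γ → V) → (C → V → Γ) → [ c? ×-dec ¬? γ? ] + [ c? ] * [ v? ] ≡ [ c? ]
indicator-split (no _)  γ?      v?      _   _   = cong (λ t → 0ℚ + t) (ℚP.*-zeroˡ [ v? ])
indicator-split (yes _) (yes _) (yes _) _   _   = refl
indicator-split (yes c) (yes γ) (no ¬v) γ→v _   = contradiction (γ→v c γ) ¬v
indicator-split (yes c) (no ¬γ) (yes v) _   v→γ = contradiction (v→γ c v) ¬γ
indicator-split (yes _) (no _)  (no _)  _   _   = refl

count-pos : ∀ {m} {Q : Fin m → Set} (Q? : ∀ x → Dec (Q x)) {x} → Q x → 0 ℕ.< count Q?
count-pos Q? {x} qx = filter-some Q? (lose (∈-allFin x) qx)

module Covers {m : ℕ} (P : FinPoset m) where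

  _≺_ : Fin m → Fin m → Set
  _≺_ = _<_ P

  _⋖ₚ_ : Fin m → Fin m → Set
  _⋖ₚ_ = _⋖_ P

  _⋖?ₚ_ : (a b : Fin m) → Dec (a ⋖ₚ b)
  _⋖?ₚ_ = _⋖?_ P

  -- In a finite poset every element strictly above some b has a lower
  -- cover: climb from b towards x, which terminates because the converse
  -- strict order on Fin m is well-founded.
  lower-cover : ∀ {b x} → b ≺ x → ∃[ w ] (w ⋖ₚ x)
  lower-cover {b} {x} = climb (po-noetherian (FinPoset.isPartialOrder P) b)
    where
    climb : ∀ {b} → Acc (flip _≺_) b → b ≺ x → ∃[ w ] (w ⋖ₚ x)
    climb {b} (acc above) b≺x with any? (λ c → (_<?_ P b c) ×-dec (_<?_ P c x))
    ... | yes (c , b≺c , c≺x) = climb (above b≺c) c≺x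
    ... | no  nothing-between = b , b≺x , nothing-between

module Ranked {m : ℕ} (P : FinPoset m) (r : Fin m → ℕ) (isRank : IsRankFunction P r) where

  open Covers P public

  rank-cover : ∀ {w x} → w ⋖ₚ x → r x ≡ suc (r w)
  rank-cover {w} {x} = proj₂ isRank w x

  rank0-minimal : ∀ {b x} → r x ≡ 0 → ¬ (b ≺ x)
  rank0-minimal rx≡0 b≺x with lower-cover b≺x
  ... | w , w⋖x = ℕP.0≢1+n (trans (sym rx≡0) (rank-cover w⋖x))

  positive-rank-cover : ∀ {x} → r x ≢ 0 → ∃[ w ] (w ⋖ₚ x)
  positive-rank-cover {x} rx≢0 with any? (λ b → _<?_ P b x)
  ... | yes (b , b≺x) = lower-cover b≺x
  ... | no  minimal   = contradiction (proj₁ isRank x minimal) rx≢0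

  rank-below-cover : ∀ {w x k} → w ⋖ₚ x → r x ≡ suc k → r w ≡ k
  rank-below-cover w⋖x rx≡1+k = ℕP.suc-injective (trans (sym (rank-cover w⋖x)) rx≡1+k)

  cover-at-rank : ∀ k x → r x ≡ k → ∀ {i} → i ℕ.< k → ∃[ w ] ∃[ z ] ((w ⋖ₚ z) × (r w ≡ i))
  cover-at-rank (suc k) x rx≡1+k {i} (s≤s i≤k) = descend (positive-rank-cover rx≢0)
    where
    rx≢0 : r x ≢ 0
    rx≢0 rx≡0 = ℕP.1+n≢0 (trans (sym rx≡1+k) rx≡0)
    descend : ∃[ w ] (w ⋖ₚ x) → ∃[ w ] ∃[ z ] ((w ⋖ₚ z) × (r w ≡ i))
    descend (w , w⋖x) with i ℕP.≟ k
    ... | yes i≡k = w , x , w⋖x , trans (rank-below-cover w⋖x rx≡1+k) (sym i≡k)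
    ... | no  i≢k = cover-at-rank k w (rank-below-cover w⋖x rx≡1+k) (ℕP.≤∧≢⇒< i≤k i≢k)

module Regular {m : ℕ} (P : FinPoset m) (r : Fin m → ℕ) (isRank : IsRankFunction P r)
               (dp dm : ℕ → ℕ) (regular : IsRegular P r dp dm) where

  open Ranked P r isRank

  Nᵣ : ℕ → ℕ
  Nᵣ = N P r

  rank-weight : ℕ → ℚ
  rank-weight i = 1 // Nᵣ i

  cover-weight : ℕ → ℚ
  cover-weight i = 1 // (dm i ℕ.* Nᵣ i)

  N-positive : ∀ x → 0 ℕ.< Nᵣ (r x)
  N-positive x = count-pos (λ z → r z ℕP.≟ r x) refl

  down-positive : ∀ {w x} → w ⋖ₚ x → 0 ℕ.< dm (r x)
  down-positive {w} {x} w⋖x = subst (0 ℕ.<_) (proj₂ (regular x)) (count-pos (_⋖?ₚ x) w⋖x)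

  cover-denominator-positive : ∀ {w x} → w ⋖ₚ x → 0 ℕ.< dm (r x) ℕ.* Nᵣ (r x)
  cover-denominator-positive {x = x} w⋖x = ℕP.*-mono-≤ (down-positive w⋖x) (N-positive x)

  sum-upper-covers : ∀ y c → Σℚ (λ x → [ y ⋖?ₚ x ] * c) ≡ ι (dp (r y)) * c
  sum-upper-covers y c = begin
    Σℚ (λ x → [ y ⋖?ₚ x ] * c)  ≡⟨ sum-*ʳ (allFin m) (λ x → [ y ⋖?ₚ x ]) c ⟩
    Σℚ (λ x → [ y ⋖?ₚ x ]) * c  ≡⟨ cong (_* c) (sum-indicator (y ⋖?ₚ_) (allFin m)) ⟩
    ι (up-deg P y) * c          ≡⟨ cong (λ k → ι k * c) (proj₁ (regular y)) ⟩
    ι (dp (r y)) * c            ∎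
    where open ≡-Reasoning

  sum-lower-covers : ∀ x c → Σℚ (λ y → [ y ⋖?ₚ x ] * c) ≡ ι (dm (r x)) * c
  sum-lower-covers x c = begin
    Σℚ (λ y → [ y ⋖?ₚ x ] * c)  ≡⟨ sum-*ʳ (allFin m) (λ y → [ y ⋖?ₚ x ]) c ⟩
    Σℚ (λ y → [ y ⋖?ₚ x ]) * c  ≡⟨ cong (_* c) (sum-indicator (_⋖?ₚ x) (allFin m)) ⟩
    ι (down-deg P x) * c        ≡⟨ cong (λ k → ι k * c) (proj₂ (regular x)) ⟩
    ι (dm (r x)) * c            ∎
    where open ≡-Reasoning

  sum-over-rank : ∀ (g : ℕ → ℕ) i → Σℚ (λ y → ι (g (r y)) * [ r y ℕP.≟ i ]) ≡ ι (Nᵣ i) * ι (g i)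
  sum-over-rank g i = begin
    Σℚ (λ y → ι (g (r y)) * [ r y ℕP.≟ i ])  ≡⟨ sum-cong (allFin m) at-rank-i ⟩
    Σℚ (λ y → [ r y ℕP.≟ i ] * ι (g i))      ≡⟨ sum-*ʳ (allFin m) (λ y → [ r y ℕP.≟ i ]) (ι (g i)) ⟩
    Σℚ (λ y → [ r y ℕP.≟ i ]) * ι (g i)      ≡⟨ cong (_* ι (g i)) (sum-indicator (λ y → r y ℕP.≟ i) (allFin m)) ⟩
    ι (Nᵣ i) * ι (g i)                       ∎
    where
    open ≡-Reasoning
    at-rank-i : ∀ y → ι (g (r y)) * [ r y ℕP.≟ i ] ≡ [ r y ℕP.≟ i ] * ι (g i)
    at-rank-i y = trans (ℚP.*-comm (ι (g (r y))) _) (indicator-*-cong (r y ℕP.≟ i) (λ ry≡i → cong (λ k → ι (g k)) ry≡i))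

  -- Double counting the covering pairs between ranks i and i+1:
  -- N_i d⁺_i = N_{i+1} d⁻_{i+1}.
  edge-count : ∀ i → ι (Nᵣ i) * ι (dp i) ≡ ι (Nᵣ (suc i)) * ι (dm (suc i))
  edge-count i = begin
    ι (Nᵣ i) * ι (dp i)                                       ≡⟨ sym (sum-over-rank dp i) ⟩
    Σℚ (λ y → ι (dp (r y)) * [ r y ℕP.≟ i ])                  ≡⟨ sum-cong (allFin m) (λ y → sym (sum-upper-covers y _)) ⟩
    Σℚ (λ y → Σℚ (λ x → [ y ⋖?ₚ x ] * [ r y ℕP.≟ i ]))        ≡⟨ sum-swap (allFin m) (allFin m) _ ⟩
    Σℚ (λ x → Σℚ (λ y → [ y ⋖?ₚ x ] * [ r y ℕP.≟ i ]))        ≡⟨ sum-cong (allFin m) (λ x → sum-cong (allFin m) (λ y → shift y x)) ⟩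
    Σℚ (λ x → Σℚ (λ y → [ y ⋖?ₚ x ] * [ r x ℕP.≟ suc i ]))    ≡⟨ sum-cong (allFin m) (λ x → sum-lower-covers x _) ⟩
    Σℚ (λ x → ι (dm (r x)) * [ r x ℕP.≟ suc i ])              ≡⟨ sum-over-rank dm (suc i) ⟩
    ι (Nᵣ (suc i)) * ι (dm (suc i))                           ∎
    where
    open ≡-Reasoning
    shift : ∀ y x → [ y ⋖?ₚ x ] * [ r y ℕP.≟ i ] ≡ [ y ⋖?ₚ x ] * [ r x ℕP.≟ suc i ]
    shift y x = indicator-*-cong (y ⋖?ₚ x) (λ y⋖x → indicator-iff (r y ℕP.≟ i) (r x ℕP.≟ suc i)
                  (λ ry≡i → trans (rank-cover y⋖x) (cong suc ry≡i))
                  (rank-below-cover y⋖x))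

  up-weight : ∀ {i} → ∃[ w ] ∃[ z ] ((w ⋖ₚ z) × (r w ≡ i)) → ι (dp i) * cover-weight (suc i) ≡ rank-weight i
  up-weight {i} (w , z , w⋖z , rw≡i) = *-//-cancel (dp i) Nᵢ>0 D>0 (begin
    ι (dp i) * ι (Nᵣ i)                     ≡⟨ ℚP.*-comm (ι (dp i)) (ι (Nᵣ i)) ⟩
    ι (Nᵣ i) * ι (dp i)                     ≡⟨ edge-count i ⟩
    ι (Nᵣ (suc i)) * ι (dm (suc i))         ≡⟨ ℚP.*-comm (ι (Nᵣ (suc i))) (ι (dm (suc i))) ⟩
    ι (dm (suc i)) * ι (Nᵣ (suc i))         ≡⟨ sym (ι-* (dm (suc i)) (Nᵣ (suc i))) ⟩
    ι (dm (suc i) ℕ.* Nᵣ (suc i))           ∎)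
    where
    open ≡-Reasoning
    rz≡1+i : r z ≡ suc i
    rz≡1+i = trans (rank-cover w⋖z) (cong suc rw≡i)
    Nᵢ>0 : 0 ℕ.< Nᵣ i
    Nᵢ>0 = subst (λ k → 0 ℕ.< Nᵣ k) rw≡i (N-positive w)
    D>0 : 0 ℕ.< dm (suc i) ℕ.* Nᵣ (suc i)
    D>0 = subst (λ k → 0 ℕ.< dm k ℕ.* Nᵣ k) rz≡1+i (cover-denominator-positive w⋖z)

  rank-mass : ∀ {i} → 0 ℕ.< Nᵣ i → Σℚ (λ x → [ r x ℕP.≟ i ] * rank-weight i) ≡ 1ℚ
  rank-mass {i} Nᵢ>0 = begin
    Σℚ (λ x → [ r x ℕP.≟ i ] * rank-weight i)   ≡⟨ sum-*ʳ (allFin m) (λ x → [ r x ℕP.≟ i ]) (rank-weight i) ⟩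
    Σℚ (λ x → [ r x ℕP.≟ i ]) * rank-weight i   ≡⟨ cong (_* rank-weight i) (sum-indicator (λ x → r x ℕP.≟ i) (allFin m)) ⟩
    ι (Nᵣ i) * rank-weight i                    ≡⟨ ℚP.*-comm (ι (Nᵣ i)) (rank-weight i) ⟩
    rank-weight i * ι (Nᵣ i)                    ≡⟨ //-*-cancel 1 Nᵢ>0 ⟩
    1ℚ                                          ∎
    where open ≡-Reasoning

module Telescoping {m : ℕ} (P : FinPoset m) (r : Fin m → ℕ) (dp dm : ℕ → ℕ) (n : ℕ)
    (isRank : IsRankFunction P r) (regular : IsRegular P r dp dm) (maxRank : IsMaxRank P r n)
    (n≥1 : 1 ℕ.≤ n) (A : Subset m) where

  open FinPoset P using (isPartialOrder) renaming (_≤_ to _⊑_)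
  open IsPartialOrder isPartialOrder using () renaming (refl to ⊑-refl; trans to ⊑-trans)
  open Ranked P r isRank
  open Regular P r isRank dp dm regular public

  InU : Fin m → Set
  InU y = ∃[ a ] ((a ∈ A) × (a ⊑ y))

  U? : ∀ y → Dec (InU y)
  U? = inUp? P r A

  up-closed : ∀ {y x} → y ⊑ x → InU y → InU x
  up-closed y⊑x (a , a∈A , a⊑y) = a , a∈A , ⊑-trans a⊑y y⊑x

  fA : Fin m → ℚ
  fA = f P r A n dm

  G : Fin m → ℚ
  G x = Σℚ (λ y → ([ y ⋖?ₚ x ] * [ U? y ]) * cover-weight (r x))

  H : Fin m → ℚ
  H x = [ U? x ] * rank-weight (r x) + [ r x ℕP.≟ n ] * ([ ¬? (U? x) ] * rank-weight n)

  -- K(y) is the total weight that y sends to its upper covers.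
  K : Fin m → ℚ
  K y = [ U? y ] * ([ ¬? (r y ℕP.≟ n) ] * rank-weight (r y))

  G-vanishes : ∀ x → (∀ y → y ⋖ₚ x → ¬ InU y) → G x ≡ 0ℚ
  G-vanishes x no-cover-in-U = trans (sum-cong (allFin m) (λ y → vanish (y ⋖?ₚ x) (U? y))) (sum-zero (allFin m))
    where
    w = cover-weight (r x)
    vanish : ∀ {y} (c? : Dec (y ⋖ₚ x)) (u? : Dec (InU y)) → ([ c? ] * [ u? ]) * w ≡ 0ℚ
    vanish (no _)      u?      = trans (cong (_* w) (ℚP.*-zeroˡ [ u? ])) (ℚP.*-zeroˡ w)
    vanish (yes y⋖x)   (yes u) = contradiction u (no-cover-in-U _ y⋖x)
    vanish (yes _)     (no _)  = ℚP.*-zeroˡ w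

  H-inside : ∀ {x} → InU x → H x ≡ rank-weight (r x)
  H-inside {x} u = by-membership (U? x)
    where
    by-membership : (u? : Dec (InU x)) →
      [ u? ] * rank-weight (r x) + [ r x ℕP.≟ n ] * ([ ¬? u? ] * rank-weight n) ≡ rank-weight (r x)
    by-membership (yes _) =
      solve 3 (λ e t eₙ → con 1ℚ :* e :+ t :* (con 0ℚ :* eₙ) := e) refl (rank-weight (r x)) [ r x ℕP.≟ n ] (rank-weight n)
    by-membership (no ¬u) = contradiction u ¬u

  H-outside : ∀ {x} → ¬ InU x → H x ≡ [ r x ℕP.≟ n ] * rank-weight n
  H-outside {x} ¬u = by-membership (U? x)
    where
    by-membership : (u? : Dec (InU x)) →
      [ u? ] * rank-weight (r x) + [ r x ℕP.≟ n ] * ([ ¬? u? ] * rank-weight n) ≡ [ r x ℕP.≟ n ] * rank-weight n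
    by-membership (yes u) = contradiction u ¬u
    by-membership (no _) =
      solve 3 (λ e t eₙ → con 0ℚ :* e :+ t :* (con 1ℚ :* eₙ) := t :* eₙ) refl (rank-weight (r x)) [ r x ℕP.≟ n ] (rank-weight n)

  bottom-in-U : ∀ {x} → r x ≡ 0 → InU x → x ∈ A
  bottom-in-U {x} rx≡0 (a , a∈A , a⊑x) with a ≟ x
  ... | yes a≡x = subst (_∈ A) a≡x a∈A
  ... | no  a≢x = contradiction (a⊑x , a≢x) (rank0-minimal rx≡0)

  Γ⁺→U : ∀ {x y} → y ⋖ₚ x → (r y ≡ r x ∸ 1) × ∃[ a ] (((a ∈ A) × (a ⊑ x)) × (a ⊑ y)) → InU y
  Γ⁺→U _ (_ , a , (a∈A , _) , a⊑y) = a , a∈A , a⊑y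

  U→Γ⁺ : ∀ {x y} → y ⋖ₚ x → InU y → (r y ≡ r x ∸ 1) × ∃[ a ] (((a ∈ A) × (a ⊑ x)) × (a ⊑ y))
  U→Γ⁺ y⋖x (a , a∈A , a⊑y) =
    sym (cong (_∸ 1) (rank-cover y⋖x)) , a , (a∈A , ⊑-trans a⊑y (proj₁ (proj₁ y⋖x))) , a⊑y

  W-nonempty : ∀ x → InU x → W P r A x ≡ count (λ y → (y ⋖?ₚ x) ×-dec ¬? (inΓ⁺? P r A x y))
  W-nonempty x u with Ax-nonempty? P r A x
  ... | yes _ = refl
  ... | no ¬u = contradiction u ¬u

  W-empty : ∀ x → ¬ InU x → W P r A x ≡ 0
  W-empty x ¬u with Ax-nonempty? P r A x
  ... | yes u = contradiction u ¬u
  ... | no _  = refl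

  W-complement : ∀ x → InU x → ι (W P r A x) + Σℚ (λ y → [ y ⋖?ₚ x ] * [ U? y ]) ≡ ι (dm (r x))
  W-complement x u = begin
    ι (W P r A x) + T                       ≡⟨ cong (λ k → ι k + T) (W-nonempty x u) ⟩
    ι (count outside?) + T                  ≡⟨ cong (_+ T) (sym (sum-indicator outside? (allFin m))) ⟩
    Σℚ (λ y → [ outside? y ]) + T           ≡⟨ sym (sum-+ (allFin m) (λ y → [ outside? y ]) _) ⟩
    Σℚ (λ y → [ outside? y ] + [ y ⋖?ₚ x ] * [ U? y ])
                                            ≡⟨ sum-cong (allFin m) (λ y → indicator-split (y ⋖?ₚ x) (inΓ⁺? P r A x y) (U? y) Γ⁺→U U→Γ⁺) ⟩
    Σℚ (λ y → [ y ⋖?ₚ x ])                  ≡⟨ sum-indicator (_⋖?ₚ x) (allFin m) ⟩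
    ι (down-deg P x)                        ≡⟨ cong ι (proj₂ (regular x)) ⟩
    ι (dm (r x))                            ∎
    where
    open ≡-Reasoning
    T = Σℚ (λ y → [ y ⋖?ₚ x ] * [ U? y ])
    outside? = λ y → (y ⋖?ₚ x) ×-dec ¬? (inΓ⁺? P r A x y)

  W-term : ∀ x → InU x → r x ≢ 0 → W P r A x // (dm (r x) ℕ.* Nᵣ (r x)) ≡ rank-weight (r x) - G x
  W-term x u rx≢0 = begin
    W P r A x // D                       ≡⟨ //-split (W P r A x) D>0 ⟩
    ι (W P r A x) * c                    ≡⟨ solve 3 (λ w t c → w :* c := (w :+ t) :* c :- t :* c) refl (ι (W P r A x)) T c ⟩
    (ι (W P r A x) + T) * c - T * c      ≡⟨ cong₂ (λ a b → a * c - b) (W-complement x u) (sym (sum-*ʳ (allFin m) _ c)) ⟩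
    ι (dm (r x)) * c - G x               ≡⟨ cong (_- G x) (*-//-cancel (dm (r x)) (N-positive x) D>0 (sym (ι-* (dm (r x)) (Nᵣ (r x))))) ⟩
    rank-weight (r x) - G x              ∎
    where
    open ≡-Reasoning
    D = dm (r x) ℕ.* Nᵣ (r x)
    c = cover-weight (r x)
    T = Σℚ (λ y → [ y ⋖?ₚ x ] * [ U? y ])
    D>0 : 0 ℕ.< D
    D>0 = cover-denominator-positive (proj₂ (positive-rank-cover rx≢0))

  -- f_A(x) with its case tests passed as explicit decisions; definitionally f_A(x).
  f-by-cases : ∀ x → Dec (r x ≡ 0) → Dec (x ∈ A) → Dec (r x ≡ n) → Dec (InU x) → ℚ
  f-by-cases x bottom? a? top? u? =
    if does bottom? then (if does a? then rank-weight 0 else 0ℚ)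
    else (if does (top? ×-dec ¬? u?) then rank-weight n else W P r A x // (dm (r x) ℕ.* Nᵣ (r x)))

  f-decomposition : ∀ x → fA x ≡ H x - G x
  f-decomposition x = by-cases (r x ℕP.≟ 0) (x ∈? A) (r x ℕP.≟ n) (U? x)
    where
    open ≡-Reasoning
    n≢0 : n ≢ 0
    n≢0 n≡0 = contradiction (subst (1 ℕ.≤_) n≡0 n≥1) λ ()
    no-covers-below : r x ≡ 0 → ∀ y → y ⋖ₚ x → ¬ InU y
    no-covers-below rx≡0 y y⋖x _ = rank0-minimal rx≡0 (proj₁ y⋖x)
    outside-covers : ¬ InU x → ∀ y → y ⋖ₚ x → ¬ InU y
    outside-covers ¬u y y⋖x uy = ¬u (up-closed (proj₁ (proj₁ y⋖x)) uy)
    outside : ¬ InU x → (top? : Dec (r x ≡ n)) → H x - G x ≡ [ top? ] * rank-weight n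
    outside ¬u top? = begin
      H x - G x                                  ≡⟨ cong₂ _-_ (H-outside ¬u) (G-vanishes x (outside-covers ¬u)) ⟩
      [ r x ℕP.≟ n ] * rank-weight n - 0ℚ       ≡⟨ ℚP.+-identityʳ _ ⟩
      [ r x ℕP.≟ n ] * rank-weight n             ≡⟨ cong (_* rank-weight n) (indicator-iff (r x ℕP.≟ n) top? (λ t → t) (λ t → t)) ⟩
      [ top? ] * rank-weight n                   ∎
    by-cases : ∀ bottom? a? top? u? → f-by-cases x bottom? a? top? u? ≡ H x - G x
    by-cases (yes rx≡0) _ (yes rx≡n) _ = contradiction (trans (sym rx≡n) rx≡0) n≢0
    by-cases (yes rx≡0) (yes x∈A) (no _) _ = sym (begin
      H x - G x                  ≡⟨ cong₂ _-_ (H-inside (x , x∈A , ⊑-refl)) (G-vanishes x (no-covers-below rx≡0)) ⟩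
      rank-weight (r x) - 0ℚ     ≡⟨ ℚP.+-identityʳ _ ⟩
      rank-weight (r x)          ≡⟨ cong rank-weight rx≡0 ⟩
      rank-weight 0              ∎)
    by-cases (yes rx≡0) (no x∉A) (no rx≢n) _ =
      sym (trans (outside (λ u → x∉A (bottom-in-U rx≡0 u)) (no rx≢n)) (ℚP.*-zeroˡ (rank-weight n)))
    by-cases (no _) _ (yes rx≡n) (no ¬u) =
      sym (trans (outside ¬u (yes rx≡n)) (ℚP.*-identityˡ (rank-weight n)))
    by-cases (no rx≢0) _ (yes _) (yes u) = trans (W-term x u rx≢0) (cong (_- G x) (sym (H-inside u)))
    by-cases (no rx≢0) _ (no _)  (yes u) = trans (W-term x u rx≢0) (cong (_- G x) (sym (H-inside u)))
    by-cases (no rx≢0) _ (no rx≢n) (no ¬u) = begin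
      W P r A x // D             ≡⟨ cong (_// D) (W-empty x ¬u) ⟩
      0 // D                     ≡⟨ //-split 0 (cover-denominator-positive (proj₂ (positive-rank-cover rx≢0))) ⟩
      0ℚ * cover-weight (r x)    ≡⟨ ℚP.*-zeroˡ (cover-weight (r x)) ⟩
      0ℚ                         ≡⟨ sym (ℚP.*-zeroˡ (rank-weight n)) ⟩
      0ℚ * rank-weight n         ≡⟨ sym (outside ¬u (no rx≢n)) ⟩
      H x - G x                  ∎
      where D = dm (r x) ℕ.* Nᵣ (r x)

  top-uncovered : ∀ {y x} → r y ≡ n → ¬ (y ⋖ₚ x)
  top-uncovered {y} {x} ry≡n y⋖x =
    ℕP.<-irrefl refl (subst (ℕ._≤ n) (trans (rank-cover y⋖x) (cong suc ry≡n)) (proj₂ maxRank x))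

  up-mass : ∀ y → ι (dp (r y)) * cover-weight (suc (r y)) ≡ [ ¬? (r y ℕP.≟ n) ] * rank-weight (r y)
  up-mass y = by-rank (r y ℕP.≟ n)
    where
    c = cover-weight (suc (r y))
    by-rank : (top? : Dec (r y ≡ n)) → ι (dp (r y)) * c ≡ [ ¬? top? ] * rank-weight (r y)
    by-rank (yes ry≡n) = begin
      ι (dp (r y)) * c                ≡⟨ sym (sum-upper-covers y c) ⟩
      Σℚ (λ x → [ y ⋖?ₚ x ] * c)      ≡⟨ sum-cong (allFin m) (λ x → indicator-*-cong (y ⋖?ₚ x) λ y⋖x → contradiction y⋖x (top-uncovered ry≡n)) ⟩
      Σℚ (λ x → [ y ⋖?ₚ x ] * 0ℚ)     ≡⟨ sum-cong (allFin m) (λ x → ℚP.*-zeroʳ [ y ⋖?ₚ x ]) ⟩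
      Σℚ (λ (_ : Fin m) → 0ℚ)         ≡⟨ sum-zero (allFin m) ⟩
      0ℚ                              ≡⟨ sym (ℚP.*-zeroˡ (rank-weight (r y))) ⟩
      0ℚ * rank-weight (r y)          ∎
      where open ≡-Reasoning
    by-rank (no ry≢n) = trans (up-weight (cover-at-rank n top rtop≡n (ℕP.≤∧≢⇒< (proj₂ maxRank y) ry≢n)))
                              (sym (ℚP.*-identityˡ (rank-weight (r y))))
      where
      top = proj₁ (proj₁ maxRank)
      rtop≡n = proj₂ (proj₁ maxRank)

  -- Exchanging the order of summation: the weight received through covers
  -- equals the weight sent through covers.
  sum-G : Σℚ G ≡ Σℚ K
  sum-G = trans (sum-swap (allFin m) (allFin m) _) (sum-cong (allFin m) sent)
    where
    sent : ∀ y → Σℚ (λ x → ([ y ⋖?ₚ x ] * [ U? y ]) * cover-weight (r x)) ≡ K y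
    sent y = begin
      Σℚ (λ x → ([ y ⋖?ₚ x ] * u) * cover-weight (r x))    ≡⟨ sum-cong (allFin m) via-cover ⟩
      Σℚ (λ x → [ y ⋖?ₚ x ] * (u * c))                     ≡⟨ sum-upper-covers y (u * c) ⟩
      ι (dp (r y)) * (u * c)                               ≡⟨ solve 3 (λ a u c → a :* (u :* c) := u :* (a :* c)) refl (ι (dp (r y))) u c ⟩
      u * (ι (dp (r y)) * c)                               ≡⟨ cong (u *_) (up-mass y) ⟩
      K y                                                  ∎
      where
      open ≡-Reasoning
      u = [ U? y ]
      c = cover-weight (suc (r y))
      via-cover : ∀ x → ([ y ⋖?ₚ x ] * u) * cover-weight (r x) ≡ [ y ⋖?ₚ x ] * (u * c)
      via-cover x = trans (ℚP.*-assoc [ y ⋖?ₚ x ] u _)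
                          (indicator-*-cong (y ⋖?ₚ x) (λ y⋖x → cong (λ k → u * cover-weight k) (rank-cover y⋖x)))

  H-minus-K : ∀ x → H x - K x ≡ [ r x ℕP.≟ n ] * rank-weight n
  H-minus-K x = by-cases (U? x) (r x ℕP.≟ n)
    where
    by-cases : (u? : Dec (InU x)) (top? : Dec (r x ≡ n)) →
      ([ u? ] * rank-weight (r x) + [ top? ] * ([ ¬? u? ] * rank-weight n)) - [ u? ] * ([ ¬? top? ] * rank-weight (r x))
        ≡ [ top? ] * rank-weight n
    by-cases (yes _) (yes rx≡n) rewrite rx≡n =
      solve 1 (λ e → (con 1ℚ :* e :+ con 1ℚ :* (con 0ℚ :* e)) :- con 1ℚ :* (con 0ℚ :* e) := con 1ℚ :* e) refl (rank-weight n)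
    by-cases (yes _) (no _) =
      solve 2 (λ e eₙ → (con 1ℚ :* e :+ con 0ℚ :* (con 0ℚ :* eₙ)) :- con 1ℚ :* (con 1ℚ :* e) := con 0ℚ :* eₙ) refl (rank-weight (r x)) (rank-weight n)
    by-cases (no _) (yes _) =
      solve 2 (λ e eₙ → (con 0ℚ :* e :+ con 1ℚ :* (con 1ℚ :* eₙ)) :- con 0ℚ :* (con 0ℚ :* e) := con 1ℚ :* eₙ) refl (rank-weight (r x)) (rank-weight n)
    by-cases (no _) (no _) =
      solve 2 (λ e eₙ → (con 0ℚ :* e :+ con 0ℚ :* (con 1ℚ :* eₙ)) :- con 0ℚ :* (con 1ℚ :* e) := con 0ℚ :* eₙ) refl (rank-weight (r x)) (rank-weight n)

  top-rank-inhabited : 0 ℕ.< Nᵣ n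
  top-rank-inhabited = subst (λ k → 0 ℕ.< Nᵣ k) (proj₂ (proj₁ maxRank)) (N-positive (proj₁ (proj₁ maxRank)))

mainTheorem2 : ∀ {m : ℕ} (P : FinPoset m) (r : Fin m → ℕ) (dp dm : ℕ → ℕ) (n : ℕ)
    → IsRankFunction P r → IsRegular P r dp dm → IsMaxRank P r n → 1 ≤ n
    → (A : Subset m)
    → Σℚ (f P r A n dm) ≡ 1ℚ
mainTheorem2 {m} P r dp dm n isRank regular maxRank n≥1 A = begin
  Σℚ fA                                       ≡⟨ sum-cong (allFin m) f-decomposition ⟩
  Σℚ (λ x → H x - G x)                        ≡⟨ sum-- (allFin m) H G ⟩
  Σℚ H - Σℚ G                                 ≡⟨ cong (Σℚ H -_) sum-G ⟩
  Σℚ H - Σℚ K                                 ≡⟨ sym (sum-- (allFin m) H K) ⟩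
  Σℚ (λ x → H x - K x)                        ≡⟨ sum-cong (allFin m) H-minus-K ⟩
  Σℚ (λ x → [ r x ℕP.≟ n ] * rank-weight n)   ≡⟨ rank-mass top-rank-inhabited ⟩
  1ℚ                                          ∎
  where
  open ≡-Reasoning
  open Telescoping P r dp dm n isRank regular maxRank n≥1 A
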